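{- For $n\ge 3$ with $n\ne 4$, the unidirectional cycle $\overrightarrow{C_n}$ is $\{0,2\}$-antimagic.
   Context: The unidirectional cycle $\overrightarrow{C_n}$ has vertices $v_1,\dots,v_n$ and arcs $(v_i,v_{i+1})$ for $1\le i\le n-1$ and $(v_n,v_1)$, so $d(v_i,v_j)=(j-i)\bmod n$, where $d(u,y)$ is the length of a shortest directed path. $N_D(v)=\{y:d(v,y)\in D\}$; a bijection $f:V\to\{1,\dots,n\}$ is $D$-antimagic if $\omega_D(v)=\sum_{y\in N_D(v)}f(y)$ are pairwise distinct; the graph is $D$-antimagic if such a bijection exists. -}

module Defs where

open import Data.Nat using (ℕ; zero; suc; _+_; _∸_; _%_; NonZero)
open import Data.Nat.Properties using (_≟_)
open import Data.Fin using (Fin; toℕ)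
open import Data.List using (List; filter; map; _∷_; [])
open import Data.Nat.ListAction using (sum)
open import Data.Product using (Σ)
open import Data.List.Membership.DecPropositional _≟_ using (_∈?_)
open import Data.List.Base using (allFin)
open import Function.Bundles using (_⤖_; Bijection)
open import Function.Definitions using (Injective)
open import Relation.Binary.PropositionalEquality using (_≡_)

-- Unidirectional cycle C_n on vertex set Fin n (vertex v_{i+1} is i : Fin n).
-- d(v_i, v_j) = (j - i) mod n, computed as (j + n - i) mod n.
dist : (n : ℕ) → .{{_ : NonZero n}} → Fin n → Fin n → ℕ
dist n i j = (toℕ j + n ∸ toℕ i) % n

neighD : (n : ℕ) → .{{_ : NonZero n}} → List ℕ → Fin n → List (Fin n)
neighD n D v = filter (λ y → dist n v y ∈? D) (allFin n)

-- A labeling is a bijection f : V → {1,…,n}; we represent it as a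
-- bijection Fin n ⤖ Fin n, the label of v being toℕ (f v) + 1.
label : {n : ℕ} → (Fin n ⤖ Fin n) → Fin n → ℕ
label f v = suc (toℕ (Bijection.to f v))

weight : (n : ℕ) → .{{_ : NonZero n}} → List ℕ → (Fin n ⤖ Fin n) → Fin n → ℕ
weight n D f v = sum (map (label f) (neighD n D v))

IsDAntimagicLabeling : (n : ℕ) → .{{_ : NonZero n}} → List ℕ → (Fin n ⤖ Fin n) → Set
IsDAntimagicLabeling n D f = Injective _≡_ _≡_ (weight n D f)

CycleDAntimagic : (n : ℕ) → .{{_ : NonZero n}} → List ℕ → Set
CycleDAntimagic n D = Σ (Fin n ⤖ Fin n) (IsDAntimagicLabeling n D)

-- The out-neighbourhood of v for distances {0, 2} is {v, v + 2}, so ω(v) = f(v) + f(v + 2).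
-- For n odd, label v_i by i: then ω(v_i) = 2i + 2 except at the last two vertices, whose
-- weights n and n + 2 are odd. For n ≥ 6 even, label v_i by i but swap the labels of v_1
-- and v_n: then ω(v_i) = 2i + 2 except at v_1, v_{n-2}, v_{n-1}, v_n, whose weights
-- n + 3, n - 1, 2n - 1, 3 are odd and distinct. An even weight determines its vertex, and
-- no even weight equals an odd one.
module Submission where

open import Data.Empty using (⊥-elim)
open import Data.Fin using (Fin; zero; suc; toℕ; fromℕ)
open import Data.Fin.Permutation using (transpose)
import Data.Fin.Permutation.Components as PC
open import Data.Fin.Properties using (toℕ<n; toℕ-fromℕ<; toℕ-fromℕ; toℕ-injective) renaming (_≟_ to _≟ᶠ_)
open import Data.List using (_∷_; []; allFin)
open import Data.List.Membership.Propositional using (_∈_)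
open import Data.List.Membership.Propositional.Properties using (∈-filter⁺; ∈-filter⁻; ∈-allFin)
open import Data.List.Membership.Propositional.Properties.WithK using (unique∧set⇒bag)
open import Data.List.Relation.Binary.BagAndSetEquality using (∼bag⇒↭)
open import Data.List.Relation.Binary.Permutation.Propositional using (_↭_)
import Data.List.Relation.Binary.Permutation.Propositional.Properties as ↭
open import Data.List.Relation.Unary.All using ([]; _∷_)
open import Data.List.Relation.Unary.AllPairs using ([]; _∷_)
open import Data.List.Relation.Unary.Any using (here; there)
open import Data.List.Relation.Unary.Unique.Propositional.Properties using (filter⁺; allFin⁺)
open import Data.Nat using (ℕ; zero; suc; _+_; _*_; _∸_; _%_; _<_; _≤_; z≤n; s≤s; NonZero)
open import Data.Nat.DivMod using (_mod_; %-distribˡ-+; m%n%n≡m%n; [m+n]%n≡m%n; m<n⇒m%n≡m; n%n≡0)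
open import Data.Nat.ListAction.Properties using (sum-↭)
open import Data.Nat.Properties
open import Data.Nat.Tactic.RingSolver using (solve-∀)
open import Data.List.Membership.DecPropositional _≟_ using (_∈?_)
open import Data.Product using (∃-syntax; _×_; _,_; proj₁; proj₂)
open import Data.Sum using (_⊎_; inj₁; inj₂)
open import Function.Base using (_∘_)
open import Function.Bundles using (_⤖_; mk⇔)
open import Function.Construct.Identity using (⤖-id)
open import Function.Definitions using (Injective)
open import Function.Properties.Inverse using (↔⇒⤖)
open import Relation.Binary.PropositionalEquality
open import Relation.Nullary using (yes; no; contradiction)
open import Relation.Nullary.Decidable using (dec-true; dec-false)

open import Defs

[m%d+n]%d≡[m+n]%d : ∀ m n d .{{_ : NonZero d}} → (m % d + n) % d ≡ (m + n) % d
[m%d+n]%d≡[m+n]%d m n d = begin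
  (m % d + n) % d             ≡⟨ %-distribˡ-+ (m % d) n d ⟩
  (m % d % d + n % d) % d     ≡⟨ cong (λ x → (x + n % d) % d) (m%n%n≡m%n m d) ⟩
  (m % d + n % d) % d         ≡⟨ %-distribˡ-+ m n d ⟨
  (m + n) % d                 ∎
  where open ≡-Reasoning

module _ {n : ℕ} .{{_ : NonZero n}} where

  shift : ℕ → Fin n → Fin n
  shift k v = (k + toℕ v) mod n

  toℕ-shift : ∀ k v → toℕ (shift k v) ≡ (k + toℕ v) % n
  toℕ-shift k v = toℕ-fromℕ< _

  toℕ-shift-< : ∀ {k} v → k + toℕ v < n → toℕ (shift k v) ≡ k + toℕ v
  toℕ-shift-< {k} v k+a<n = trans (toℕ-shift k v) (m<n⇒m%n≡m k+a<n)

  toℕ-shift-wrap : ∀ {k r} v → k + toℕ v ≡ r + n → r < n → toℕ (shift k v) ≡ r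
  toℕ-shift-wrap {k} {r} v k+a≡r+n r<n = begin
    toℕ (shift k v)   ≡⟨ toℕ-shift k v ⟩
    (k + toℕ v) % n   ≡⟨ cong (_% n) k+a≡r+n ⟩
    (r + n) % n       ≡⟨ [m+n]%n≡m%n r n ⟩
    r % n             ≡⟨ m<n⇒m%n≡m r<n ⟩
    r                 ∎
    where open ≡-Reasoning

  shift-zero : ∀ v → shift 0 v ≡ v
  shift-zero v = toℕ-injective (toℕ-shift-< v (toℕ<n v))

  shift-dist : ∀ v y → shift (dist n v y) v ≡ y
  shift-dist v y = toℕ-injective (begin
    toℕ (shift (dist n v y) v)   ≡⟨ toℕ-shift _ v ⟩
    ((b + n ∸ a) % n + a) % n    ≡⟨ [m%d+n]%d≡[m+n]%d (b + n ∸ a) a n ⟩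
    ((b + n ∸ a) + a) % n        ≡⟨ cong (_% n) (m∸n+n≡m a≤b+n) ⟩
    (b + n) % n                  ≡⟨ [m+n]%n≡m%n b n ⟩
    b % n                        ≡⟨ m<n⇒m%n≡m (toℕ<n y) ⟩
    b                            ∎)
    where
    open ≡-Reasoning
    a = toℕ v
    b = toℕ y
    a≤b+n : a ≤ b + n
    a≤b+n = ≤-trans (<⇒≤ (toℕ<n v)) (m≤n+m n b)

  dist-shift : ∀ {d} v → d < n → dist n v (shift d v) ≡ d
  dist-shift {d} v d<n = begin
    dist n v (shift d v)           ≡⟨ cong (λ x → (x + n ∸ a) % n) (toℕ-shift d v) ⟩
    ((d + a) % n + n ∸ a) % n      ≡⟨ cong (_% n) (+-∸-assoc ((d + a) % n) a≤n) ⟩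
    ((d + a) % n + (n ∸ a)) % n    ≡⟨ [m%d+n]%d≡[m+n]%d (d + a) (n ∸ a) n ⟩
    (d + a + (n ∸ a)) % n          ≡⟨ cong (_% n) (+-assoc d a (n ∸ a)) ⟩
    (d + (a + (n ∸ a))) % n        ≡⟨ cong (λ x → (d + x) % n) (m+[n∸m]≡n a≤n) ⟩
    (d + n) % n                    ≡⟨ [m+n]%n≡m%n d n ⟩
    d % n                          ≡⟨ m<n⇒m%n≡m d<n ⟩
    d                              ∎
    where
    open ≡-Reasoning
    a = toℕ v
    a≤n : a ≤ n
    a≤n = <⇒≤ (toℕ<n v)

  dist-self : ∀ v → dist n v v ≡ 0
  dist-self v = trans (cong (_% n) (m+n∸m≡n (toℕ v) n)) (n%n≡0 n)

  dist≡⇒≡shift : ∀ {d} v y → dist n v y ≡ d → y ≡ shift d v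
  dist≡⇒≡shift v y refl = sym (shift-dist v y)

  neighD-0-k-↭ : ∀ {k} v → 0 < k → k < n → neighD n (0 ∷ k ∷ []) v ↭ v ∷ shift k v ∷ []
  neighD-0-k-↭ {k} v 0<k k<n =
    ∼bag⇒↭ (unique∧set⇒bag (filter⁺ _ (allFin⁺ n)) ((v≢w ∷ []) ∷ [] ∷ []) (mk⇔ to from))
    where
    w = shift k v
    v≢w : v ≢ w
    v≢w v≡w = <⇒≢ 0<k (begin
      0            ≡⟨ dist-self v ⟨
      dist n v v   ≡⟨ cong (dist n v) v≡w ⟩
      dist n v w   ≡⟨ dist-shift v k<n ⟩
      k            ∎)
      where open ≡-Reasoning
    to : ∀ {y} → y ∈ neighD n (0 ∷ k ∷ []) v → y ∈ v ∷ w ∷ []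
    to {y} y∈ with proj₂ (∈-filter⁻ (λ y → dist n v y ∈? (0 ∷ k ∷ [])) {xs = allFin n} y∈)
    ... | here d≡0         = here (trans (dist≡⇒≡shift v y d≡0) (shift-zero v))
    ... | there (here d≡k) = there (here (dist≡⇒≡shift v y d≡k))
    from : ∀ {y} → y ∈ v ∷ w ∷ [] → y ∈ neighD n (0 ∷ k ∷ []) v
    from (here refl)         = ∈-filter⁺ _ (∈-allFin v) (here (dist-self v))
    from (there (here refl)) = ∈-filter⁺ _ (∈-allFin w) (there (here (dist-shift v k<n)))

  weight-0-k : ∀ {k} f v → 0 < k → k < n →
               weight n (0 ∷ k ∷ []) f v ≡ label f v + label f (shift k v)
  weight-0-k f v 0<k k<n = trans (sum-↭ (↭.map⁺ (label f) (neighD-0-k-↭ v 0<k k<n)))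
                                 (cong (label f v +_) (+-identityʳ _))

transpose-matchʳ : ∀ {n} (i j : Fin n) → PC.transpose i j j ≡ i
transpose-matchʳ i j with j ≟ᶠ i
... | yes j≡i = j≡i
... | no _ rewrite dec-true (j ≟ᶠ j) refl = refl

transpose-other : ∀ {n} {i j k : Fin n} → k ≢ i → k ≢ j → PC.transpose i j k ≡ k
transpose-other {i = i} {j} {k} k≢i k≢j
  rewrite dec-false (k ≟ᶠ i) k≢i | dec-false (k ≟ᶠ j) k≢j = refl

module _ {n s : ℕ} (ω : Fin n → ℕ) (special specialWeight : Fin s → ℕ) where

  injective-by-parity :
    Injective _≡_ _≡_ specialWeight →
    (∀ i → ∃[ q ] specialWeight i ≡ suc (2 * q)) →
    (∀ v → ω v ≡ 2 * (2 + toℕ v) ⊎ ∃[ i ] toℕ v ≡ special i × ω v ≡ specialWeight i) →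
    Injective _≡_ _≡_ ω
  injective-by-parity weight-inj weight-odd shape {v} {w} ωv≡ωw with shape v | shape w
  ... | inj₁ ev | inj₁ ew =
    toℕ-injective (+-cancelˡ-≡ 2 _ _ (*-cancelˡ-≡ _ _ 2 (trans (sym ev) (trans ωv≡ωw ew))))
  ... | inj₁ ev | inj₂ (j , _ , ew) =
    ⊥-elim (even≢odd (2 + toℕ v) (proj₁ (weight-odd j))
      (trans (sym ev) (trans ωv≡ωw (trans ew (proj₂ (weight-odd j))))))
  ... | inj₂ (i , _ , ev) | inj₁ ew =
    ⊥-elim (even≢odd (2 + toℕ w) (proj₁ (weight-odd i))
      (trans (sym ew) (trans (sym ωv≡ωw) (trans ev (proj₂ (weight-odd i))))))
  ... | inj₂ (i , av , ev) | inj₂ (j , aw , ew) with weight-inj (trans (sym ev) (trans ωv≡ωw ew))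
  ...   | refl = toℕ-injective (trans av (sym aw))

interior-weight : ∀ a → suc a + suc (2 + a) ≡ 2 * (2 + a)
interior-weight = solve-∀

1+2c+m≡1+2[c+k] : ∀ c {m k} → m ≡ 2 * k → suc (2 * c) + m ≡ suc (2 * (c + k))
1+2c+m≡1+2[c+k] c {k = k} refl = cong suc (sym (*-distribˡ-+ 2 c k))

module IdentityLabelling (m : ℕ) where

  ω : Fin (3 + m) → ℕ
  ω = weight (3 + m) (0 ∷ 2 ∷ []) (⤖-id _)

  special specialWeight : Fin 2 → ℕ
  special zero = 1 + m
  special (suc zero) = 2 + m
  specialWeight zero = 3 + m
  specialWeight (suc zero) = 5 + m

  specialWeight-injective : Injective _≡_ _≡_ specialWeight
  specialWeight-injective {zero} {zero} _ = refl
  specialWeight-injective {zero} {suc zero} ()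
  specialWeight-injective {suc zero} {zero} ()
  specialWeight-injective {suc zero} {suc zero} _ = refl

  specialWeight-odd : ∀ k → m ≡ 2 * k → ∀ i → ∃[ q ] specialWeight i ≡ suc (2 * q)
  specialWeight-odd k m≡2k zero = 1 + k , 1+2c+m≡1+2[c+k] 1 m≡2k
  specialWeight-odd k m≡2k (suc zero) = 2 + k , 1+2c+m≡1+2[c+k] 2 m≡2k

  ω-at : ∀ v {a b} → toℕ v ≡ a → toℕ (shift 2 v) ≡ b → ω v ≡ suc a + suc b
  ω-at v refl refl = weight-0-k (⤖-id _) v (s≤s z≤n) (s≤s (s≤s (s≤s z≤n)))

  shape : ∀ v → ω v ≡ 2 * (2 + toℕ v) ⊎ ∃[ i ] toℕ v ≡ special i × ω v ≡ specialWeight i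
  shape v with m<1+n⇒m<n∨m≡n (toℕ<n v)
  ... | inj₂ a≡2+m = inj₂ (suc zero , a≡2+m ,
    trans (ω-at v a≡2+m (toℕ-shift-wrap v (cong (2 +_) a≡2+m) (s≤s (s≤s z≤n))))
          (cong (3 +_) (+-comm m 2)))
  ... | inj₁ a<2+m with m<1+n⇒m<n∨m≡n a<2+m
  ...   | inj₂ a≡1+m = inj₂ (zero , a≡1+m ,
    trans (ω-at v a≡1+m (toℕ-shift-wrap v (cong (2 +_) a≡1+m) (s≤s z≤n)))
          (cong (2 +_) (+-comm m 1)))
  ...   | inj₁ a<1+m = inj₁ (trans (ω-at v refl (toℕ-shift-< v (s≤s (s≤s a<1+m))))
                                   (interior-weight (toℕ v)))

  antimagic : ∀ k → m ≡ 2 * k → CycleDAntimagic (3 + m) (0 ∷ 2 ∷ [])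
  antimagic k m≡2k =
    ⤖-id _ , injective-by-parity ω special specialWeight specialWeight-injective
                                 (specialWeight-odd k m≡2k) shape

module SwappedLabelling (m : ℕ) where

  last : Fin (6 + m)
  last = fromℕ (5 + m)

  σ : Fin (6 + m) ⤖ Fin (6 + m)
  σ = ↔⇒⤖ (transpose zero last)

  ω : Fin (6 + m) → ℕ
  ω = weight (6 + m) (0 ∷ 2 ∷ []) σ

  label-first : ∀ v → toℕ v ≡ 0 → label σ v ≡ 6 + m
  label-first v a≡0 rewrite toℕ-injective {i = v} {j = zero} a≡0 = cong suc (toℕ-fromℕ (5 + m))

  label-last : ∀ v → toℕ v ≡ 5 + m → label σ v ≡ 1
  label-last v a≡5+m rewrite toℕ-injective {i = v} {j = last} (trans a≡5+m (sym (toℕ-fromℕ (5 + m)))) =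
    cong (suc ∘ toℕ) (transpose-matchʳ zero last)

  label-middle : ∀ v {a} → toℕ v ≡ a → 0 < a → a < 5 + m → label σ v ≡ suc a
  label-middle v refl 0<a a<5+m = cong (suc ∘ toℕ) (transpose-other v≢first v≢last)
    where
    v≢first : v ≢ zero
    v≢first v≡0 = <⇒≢ 0<a (sym (cong toℕ v≡0))
    v≢last : v ≢ last
    v≢last v≡last = <⇒≢ a<5+m (trans (cong toℕ v≡last) (toℕ-fromℕ (5 + m)))

  ω-by-labels : ∀ v {x y} → label σ v ≡ x → label σ (shift 2 v) ≡ y → ω v ≡ x + y
  ω-by-labels v ℓv ℓw = trans (weight-0-k σ v (s≤s z≤n) (s≤s (s≤s (s≤s z≤n)))) (cong₂ _+_ ℓv ℓw)

  special specialWeight : Fin 4 → ℕ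
  special zero = 0
  special (suc zero) = 3 + m
  special (suc (suc zero)) = 4 + m
  special (suc (suc (suc zero))) = 5 + m
  specialWeight zero = 9 + m
  specialWeight (suc zero) = 5 + m
  specialWeight (suc (suc zero)) = 11 + (m + m)
  specialWeight (suc (suc (suc zero))) = 3

  -- m is kept abstract (evenness enters only in specialWeight-odd), so that the unifier
  -- refutes most collisions, e.g. 5 + m ≡ 9 + m by a cycle in m.
  specialWeight-injective : Injective _≡_ _≡_ specialWeight
  specialWeight-injective {zero} {zero} _ = refl
  specialWeight-injective {zero} {suc zero} ()
  specialWeight-injective {zero} {suc (suc zero)} e = contradiction (+-cancelˡ-≡ 9 _ _ e) (m≢1+n+m m)
  specialWeight-injective {zero} {suc (suc (suc zero))} ()
  specialWeight-injective {suc zero} {zero} ()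
  specialWeight-injective {suc zero} {suc zero} _ = refl
  specialWeight-injective {suc zero} {suc (suc zero)} e = contradiction (+-cancelˡ-≡ 5 _ _ e) (m≢1+n+m m)
  specialWeight-injective {suc zero} {suc (suc (suc zero))} ()
  specialWeight-injective {suc (suc zero)} {zero} e = contradiction (+-cancelˡ-≡ 9 _ _ (sym e)) (m≢1+n+m m)
  specialWeight-injective {suc (suc zero)} {suc zero} e = contradiction (+-cancelˡ-≡ 5 _ _ (sym e)) (m≢1+n+m m)
  specialWeight-injective {suc (suc zero)} {suc (suc zero)} _ = refl
  specialWeight-injective {suc (suc zero)} {suc (suc (suc zero))} ()
  specialWeight-injective {suc (suc (suc zero))} {zero} ()
  specialWeight-injective {suc (suc (suc zero))} {suc zero} ()
  specialWeight-injective {suc (suc (suc zero))} {suc (suc zero)} ()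
  specialWeight-injective {suc (suc (suc zero))} {suc (suc (suc zero))} _ = refl

  specialWeight-odd : ∀ k → m ≡ 2 * k → ∀ i → ∃[ q ] specialWeight i ≡ suc (2 * q)
  specialWeight-odd k m≡2k zero = 4 + k , 1+2c+m≡1+2[c+k] 4 m≡2k
  specialWeight-odd k m≡2k (suc zero) = 2 + k , 1+2c+m≡1+2[c+k] 2 m≡2k
  specialWeight-odd k m≡2k (suc (suc zero)) = 5 + m , 1+2c+m≡1+2[c+k] 5 (cong (m +_) (sym (+-identityʳ m)))
  specialWeight-odd k m≡2k (suc (suc (suc zero))) = 1 , refl

  shape : ∀ v → ω v ≡ 2 * (2 + toℕ v) ⊎ ∃[ i ] toℕ v ≡ special i × ω v ≡ specialWeight i
  shape v with m<1+n⇒m<n∨m≡n (toℕ<n v)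
  ... | inj₂ a≡5+m = inj₂ (suc (suc (suc zero)) , a≡5+m ,
    ω-by-labels v (label-last v a≡5+m)
      (label-middle (shift 2 v) (toℕ-shift-wrap v (cong (2 +_) a≡5+m) (s≤s (s≤s z≤n)))
                    (s≤s z≤n) (s≤s (s≤s z≤n))))
  ... | inj₁ a<5+m with m<1+n⇒m<n∨m≡n a<5+m
  ...   | inj₂ a≡4+m = inj₂ (suc (suc zero) , a≡4+m ,
    trans (ω-by-labels v (label-middle v a≡4+m (s≤s z≤n) (n<1+n (4 + m)))
                         (label-first (shift 2 v) (toℕ-shift-wrap v (cong (2 +_) a≡4+m) (s≤s z≤n))))
          (cong (5 +_) (+-comm m (6 + m))))
  ...   | inj₁ a<4+m with m<1+n⇒m<n∨m≡n a<4+m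
  ...     | inj₂ a≡3+m = inj₂ (suc zero , a≡3+m ,
    trans (ω-by-labels v (label-middle v a≡3+m (s≤s z≤n) (n≤1+n (4 + m)))
                         (label-last (shift 2 v) (trans (toℕ-shift-< v (s≤s (s≤s a<4+m))) (cong (2 +_) a≡3+m))))
          (cong (4 +_) (+-comm m 1)))
  ...     | inj₁ a<3+m with m≤n⇒m<n∨m≡n (z≤n {toℕ v})
  ...       | inj₂ 0≡a = inj₂ (zero , sym 0≡a ,
    trans (ω-by-labels v (label-first v (sym 0≡a))
                         (label-middle (shift 2 v) (trans (toℕ-shift-< v (s≤s (s≤s a<4+m))) (cong (2 +_) (sym 0≡a)))
                                       (s≤s z≤n) (s≤s (s≤s (s≤s z≤n)))))
          (cong (6 +_) (+-comm m 3)))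
  ...       | inj₁ 0<a = inj₁ (trans
    (ω-by-labels v (label-middle v refl 0<a (<-trans a<3+m (s≤s (s≤s (n≤1+n _)))))
                   (label-middle (shift 2 v) (toℕ-shift-< v (s≤s (s≤s a<4+m))) (s≤s z≤n) (s≤s (s≤s a<3+m))))
    (interior-weight (toℕ v)))

  antimagic : ∀ k → m ≡ 2 * k → CycleDAntimagic (6 + m) (0 ∷ 2 ∷ [])
  antimagic k m≡2k =
    σ , injective-by-parity ω special specialWeight specialWeight-injective
                            (specialWeight-odd k m≡2k) shape

even⊎odd : ∀ n → ∃[ k ] (n ≡ 2 * k ⊎ n ≡ suc (2 * k))
even⊎odd zero = 0 , inj₁ refl
even⊎odd (suc n) with even⊎odd n
... | k , inj₁ n≡2k   = k , inj₂ (cong suc n≡2k)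
... | k , inj₂ n≡1+2k = suc k , inj₁ (trans (cong suc n≡1+2k) (sym (*-suc 2 k)))

mainTheorem17 : (n : ℕ) → .{{_ : NonZero n}} → 3 ≤ n → n ≢ 4 →
    CycleDAntimagic n (0 ∷ 2 ∷ [])
mainTheorem17 1 (s≤s ()) _
mainTheorem17 2 (s≤s (s≤s ())) _
mainTheorem17 (suc (suc (suc m))) _ n≢4 with even⊎odd m
... | k , inj₁ m≡2k = IdentityLabelling.antimagic m k m≡2k
... | zero , inj₂ refl = contradiction refl n≢4
... | suc k , inj₂ refl =
  subst (λ x → CycleDAntimagic (3 + x) (0 ∷ 2 ∷ [])) (cong suc (sym (*-suc 2 k)))
        (SwappedLabelling.antimagic (2 * k) k refl)
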